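{- Let $j\ge1$ and let $(u,v)$ be a Hofstadter G pair such that the Zeckendorf representation $\beta$ of $v$ has $\beta_1=\cdots=\beta_{j-1}=0$ and $\beta_j=1$. Let $\delta(u,v)=-u+\phi^{ -1}v$. If $j$ is odd then $-\phi^{ -j}<\delta(u,v)<-\phi^{ -(j+2)}$; if $j$ is even then $\phi^{ -(j+2)}<\delta(u,v)<\phi^{ -j}$.
   Context: $F_0=0$, $F_1=1$, $F_i=F_{i-1}+F_{i-2}$; $\phi=(1+\sqrt5)/2$. For a bit string $\beta=\langle\beta_1\ldots\beta_\ell\rangle$, $\mathrm{FibSum}(\beta)=\sum_{i=1}^\ell\beta_iF_{i+1}$. The Zeckendorf representation of a positive integer $m$ is the unique bit string $\beta$ with $\mathrm{FibSum}(\beta)=m$, $\beta_\ell=1$, and no two consecutive 1s. Hofstadter's G function is $G(x)=\lfloor\phi^{ -1}(x+1)\rfloor$ for integers $x\ge0$. A Hofstadter G pair is a pair $(u,v)$ of positive integers with $u=G(v)$. -}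

module Defs where

open import Data.Nat as ℕ using (ℕ; zero; suc)
open import Data.Integer as ℤ using (ℤ; +_; 0ℤ; 1ℤ)
open import Data.Bool using (Bool; true; false; if_then_else_)
open import Data.List using (List; []; _∷_; _++_; [_])
open import Data.Product using (_×_; _,_; ∃)
open import Data.Sum using (_⊎_)
open import Data.Empty using (⊥)
open import Relation.Binary.PropositionalEquality using (_≡_)

fib : ℕ → ℕ
fib zero = 0
fib (suc zero) = 1
fib (suc (suc n)) = fib (suc n) ℕ.+ fib n

fibSumFrom : ℕ → List Bool → ℕ
fibSumFrom i [] = 0
fibSumFrom i (b ∷ bs) = (if b then fib (suc i) else 0) ℕ.+ fibSumFrom (suc i) bs

FibSum : List Bool → ℕ
FibSum β = fibSumFrom 1 β

-- 1-indexed access: bit β i = β_i (and 0 when i is out of range)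
bit : List Bool → ℕ → Bool
bit [] i = false
bit (b ∷ bs) zero = false
bit (b ∷ bs) (suc zero) = b
bit (b ∷ bs) (suc (suc i)) = bit bs (suc i)

NoConsecutiveOnes : List Bool → Set
NoConsecutiveOnes [] = Data.Unit.⊤ where import Data.Unit
NoConsecutiveOnes (true ∷ true ∷ bs) = ⊥
NoConsecutiveOnes (b ∷ bs) = NoConsecutiveOnes bs

IsZeckendorf : ℕ → List Bool → Set
IsZeckendorf m β = (FibSum β ≡ m) × (∃ λ γ → β ≡ γ ++ [ true ]) × NoConsecutiveOnes β

-- The ring ℤ[φ], φ = (1+√5)/2: the pair (a , b) denotes the real a + bφ.

record ℤφ : Set where
  constructor _+_φ
  field
    re : ℤ
    im : ℤ
open ℤφ public

infixl 6 _⊕_ _⊖_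
infixl 7 _⊗_

_⊕_ : ℤφ → ℤφ → ℤφ
(a + b φ) ⊕ (c + d φ) = (a ℤ.+ c) + (b ℤ.+ d) φ

⊝_ : ℤφ → ℤφ
⊝ (a + b φ) = (ℤ.- a) + (ℤ.- b) φ

_⊖_ : ℤφ → ℤφ → ℤφ
x ⊖ y = x ⊕ (⊝ y)

-- (a + bφ)(c + dφ) = (ac + bd) + (ad + bc + bd)φ, using φ² = φ + 1
_⊗_ : ℤφ → ℤφ → ℤφ
(a + b φ) ⊗ (c + d φ) = (a ℤ.* c ℤ.+ b ℤ.* d) + (a ℤ.* d ℤ.+ b ℤ.* c ℤ.+ b ℤ.* d) φ

ι : ℤ → ℤφ
ι n = n + 0ℤ φ

ιℕ : ℕ → ℤφ
ιℕ n = ι (+ n)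

-- φ⁻¹ = φ - 1
φ⁻¹ : ℤφ
φ⁻¹ = ℤ.-[1+ 0 ] + 1ℤ φ

φ⁻^ : ℕ → ℤφ
φ⁻^ zero = ι 1ℤ
φ⁻^ (suc n) = φ⁻¹ ⊗ φ⁻^ n

-- Positivity of the real number p + q√5 (p, q ∈ ℤ), i.e. the usual order of ℝ
-- restricted to ℤ[√5].
PosRoot5 : ℤ → ℤ → Set
PosRoot5 p q =
     (0ℤ ℤ.≤ p × 0ℤ ℤ.≤ q × (0ℤ ℤ.< p ⊎ 0ℤ ℤ.< q))
  ⊎ (0ℤ ℤ.< p × q ℤ.< 0ℤ × (+ 5) ℤ.* (q ℤ.* q) ℤ.< p ℤ.* p)
  ⊎ (p ℤ.< 0ℤ × 0ℤ ℤ.< q × p ℤ.* p ℤ.< (+ 5) ℤ.* (q ℤ.* q))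

-- a + bφ = ((2a + b) + b√5)/2 > 0
Pos : ℤφ → Set
Pos (a + b φ) = PosRoot5 ((+ 2) ℤ.* a ℤ.+ b) b

infix 4 _<φ_ _≤φ_
_<φ_ : ℤφ → ℤφ → Set
x <φ y = Pos (y ⊖ x)

_≤φ_ : ℤφ → ℤφ → Set
x ≤φ y = (y ⊖ x) ≡ ι 0ℤ ⊎ Pos (y ⊖ x)

-- Hofstadter's G:  G(x) = ⌊φ⁻¹(x+1)⌋.  "g = ⌊r⌋" means g ≤ r < g + 1.

IsFloor : ℕ → ℤφ → Set
IsFloor g r = (ιℕ g ≤φ r) × (r <φ ιℕ (suc g))

HofstadterGPair : ℕ → ℕ → Set
HofstadterGPair u v = (1 ℕ.≤ u) × (1 ℕ.≤ v) × IsFloor u (φ⁻¹ ⊗ ιℕ (suc v))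

δ : ℕ → ℕ → ℤφ
δ u v = (⊝ ιℕ u) ⊕ (φ⁻¹ ⊗ ιℕ v)

-- Write v = Σ βᵢ F_{i+1} in Zeckendorf form and let ψ = 1 − φ = −φ⁻¹. Binet's formula
-- gives φ⁻¹ F_{i+1} = F_i − ψ^{i+1}, so φ⁻¹ v = w − t with w = Σ βᵢ F_i and t = Σ βᵢ ψ^{i+1}.
-- Because β has no two adjacent 1s, every tail Σ_{i ≥ k} βᵢ ψ^{i+1} lies strictly between
-- −ψ^k and −ψ^{k+1}. For k = 1 this gives 0 < φ⁻¹(v + 1) − w < 1, so u = G(v) = w and
-- δ(u,v) = −t; for k = j + 2, together with βⱼ = 1, it puts δ(u,v) strictly between ψ^j and
-- ψ^{j+2}, which is the claim. All comparisons take place in ℤ[φ], where φ⁻ⁿ > 0 follows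
-- from Cassini's identity: ψⁿ = F_{n+1} − F_n φ has norm (−1)ⁿ.

module Submission where

open import Defs
open import Data.Nat using (ℕ; zero; suc; _≤_; _<_; _%_; _+_; _*_; z≤n; s≤s)
open import Data.Nat.Properties
open import Data.Nat.Tactic.RingSolver using (solve)
open import Data.Integer as ℤ using (ℤ; +_; -[1+_]; 0ℤ; 1ℤ; -1ℤ; +<+; -<+; +≤+)
import Data.Integer.Properties as ℤP
open import Data.Integer.Tactic.RingSolver using () renaming (solve-∀ to ℤ-solve-∀)
open import Data.Bool using (Bool; true; false)
open import Data.List using (List; []; _∷_)
open import Data.Maybe using (Maybe; just; nothing)
open import Data.Product using (_×_; _,_; proj₁; proj₂; ∃-syntax)
open import Data.Sum using (_⊎_; inj₁; inj₂)
open import Data.Empty using (⊥-elim)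
open import Level using (0ℓ)
open import Relation.Nullary using (yes)
open import Relation.Binary.PropositionalEquality
open import Algebra.Bundles using (CommutativeRing)
open import Tactic.RingSolver.Core.AlmostCommutativeRing using (AlmostCommutativeRing; fromCommutativeRing)
open import Tactic.RingSolver using (solve-∀)

-- The ring ℤ[φ]

ℤφ-ext : ∀ {x y : ℤφ} → re x ≡ re y → im x ≡ im y → x ≡ y
ℤφ-ext refl refl = refl

⊗-assoc : ∀ x y z → (x ⊗ y) ⊗ z ≡ x ⊗ (y ⊗ z)
⊗-assoc x y z = ℤφ-ext (re-law (re x) (im x) (re y) (im y) (re z) (im z))
                       (im-law (re x) (im x) (re y) (im y) (re z) (im z))
  where
  re-law : ∀ a b c d e f → (a ℤ.* c ℤ.+ b ℤ.* d) ℤ.* e ℤ.+ (a ℤ.* d ℤ.+ b ℤ.* c ℤ.+ b ℤ.* d) ℤ.* f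
                         ≡ a ℤ.* (c ℤ.* e ℤ.+ d ℤ.* f) ℤ.+ b ℤ.* (c ℤ.* f ℤ.+ d ℤ.* e ℤ.+ d ℤ.* f)
  re-law = ℤ-solve-∀
  im-law : ∀ a b c d e f → (a ℤ.* c ℤ.+ b ℤ.* d) ℤ.* f ℤ.+ (a ℤ.* d ℤ.+ b ℤ.* c ℤ.+ b ℤ.* d) ℤ.* e ℤ.+ (a ℤ.* d ℤ.+ b ℤ.* c ℤ.+ b ℤ.* d) ℤ.* f
                         ≡ a ℤ.* (c ℤ.* f ℤ.+ d ℤ.* e ℤ.+ d ℤ.* f) ℤ.+ b ℤ.* (c ℤ.* e ℤ.+ d ℤ.* f) ℤ.+ b ℤ.* (c ℤ.* f ℤ.+ d ℤ.* e ℤ.+ d ℤ.* f)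
  im-law = ℤ-solve-∀

⊗-comm : ∀ x y → x ⊗ y ≡ y ⊗ x
⊗-comm x y = ℤφ-ext (re-law (re x) (im x) (re y) (im y)) (im-law (re x) (im x) (re y) (im y))
  where
  re-law : ∀ a b c d → a ℤ.* c ℤ.+ b ℤ.* d ≡ c ℤ.* a ℤ.+ d ℤ.* b
  re-law = ℤ-solve-∀
  im-law : ∀ a b c d → a ℤ.* d ℤ.+ b ℤ.* c ℤ.+ b ℤ.* d ≡ c ℤ.* b ℤ.+ d ℤ.* a ℤ.+ d ℤ.* b
  im-law = ℤ-solve-∀

⊗-identityˡ : ∀ x → ι 1ℤ ⊗ x ≡ x
⊗-identityˡ x = ℤφ-ext (re-law (re x) (im x)) (im-law (re x) (im x))
  where
  re-law : ∀ a b → 1ℤ ℤ.* a ℤ.+ 0ℤ ℤ.* b ≡ a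
  re-law = ℤ-solve-∀
  im-law : ∀ a b → 1ℤ ℤ.* b ℤ.+ 0ℤ ℤ.* a ℤ.+ 0ℤ ℤ.* b ≡ b
  im-law = ℤ-solve-∀

⊗-distribʳ-⊕ : ∀ x y z → (y ⊕ z) ⊗ x ≡ y ⊗ x ⊕ z ⊗ x
⊗-distribʳ-⊕ x y z = ℤφ-ext (re-law (re x) (im x) (re y) (im y) (re z) (im z))
                            (im-law (re x) (im x) (re y) (im y) (re z) (im z))
  where
  re-law : ∀ a b c d e f → (c ℤ.+ e) ℤ.* a ℤ.+ (d ℤ.+ f) ℤ.* b ≡ (c ℤ.* a ℤ.+ d ℤ.* b) ℤ.+ (e ℤ.* a ℤ.+ f ℤ.* b)
  re-law = ℤ-solve-∀
  im-law : ∀ a b c d e f → (c ℤ.+ e) ℤ.* b ℤ.+ (d ℤ.+ f) ℤ.* a ℤ.+ (d ℤ.+ f) ℤ.* b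
                         ≡ (c ℤ.* b ℤ.+ d ℤ.* a ℤ.+ d ℤ.* b) ℤ.+ (e ℤ.* b ℤ.+ f ℤ.* a ℤ.+ f ℤ.* b)
  im-law = ℤ-solve-∀

ℤφ-commutativeRing : CommutativeRing 0ℓ 0ℓ
ℤφ-commutativeRing = record
  { Carrier = ℤφ
  ; _≈_ = _≡_
  ; _+_ = _⊕_
  ; _*_ = _⊗_
  ; -_ = ⊝_
  ; 0# = ι 0ℤ
  ; 1# = ι 1ℤ
  ; isCommutativeRing = record
    { isRing = record
      { +-isAbelianGroup = record
        { isGroup = record
          { isMonoid = record
            { isSemigroup = record
              { isMagma = record { isEquivalence = isEquivalence ; ∙-cong = cong₂ _⊕_ }
              ; assoc = λ x y z → ℤφ-ext (ℤP.+-assoc (re x) (re y) (re z)) (ℤP.+-assoc (im x) (im y) (im z))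
              }
            ; identity = (λ x → ℤφ-ext (ℤP.+-identityˡ (re x)) (ℤP.+-identityˡ (im x)))
                       , (λ x → ℤφ-ext (ℤP.+-identityʳ (re x)) (ℤP.+-identityʳ (im x)))
            }
          ; inverse = (λ x → ℤφ-ext (ℤP.+-inverseˡ (re x)) (ℤP.+-inverseˡ (im x)))
                    , (λ x → ℤφ-ext (ℤP.+-inverseʳ (re x)) (ℤP.+-inverseʳ (im x)))
          ; ⁻¹-cong = cong ⊝_
          }
        ; comm = λ x y → ℤφ-ext (ℤP.+-comm (re x) (re y)) (ℤP.+-comm (im x) (im y))
        }
      ; *-cong = cong₂ _⊗_
      ; *-assoc = ⊗-assoc
      ; *-identity = ⊗-identityˡ , λ x → trans (⊗-comm x (ι 1ℤ)) (⊗-identityˡ x)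
      ; distrib = (λ x y z → trans (⊗-comm x (y ⊕ z))
                               (trans (⊗-distribʳ-⊕ x y z) (cong₂ _⊕_ (⊗-comm y x) (⊗-comm z x))))
                , ⊗-distribʳ-⊕
      }
    ; *-comm = ⊗-comm
    }
  }

-- The zero test lets the solver discard coefficients that cancel, such as 1 − 1.
ℤφ-ring : AlmostCommutativeRing 0ℓ 0ℓ
ℤφ-ring = fromCommutativeRing ℤφ-commutativeRing is-0
  where
  is-0 : ∀ x → Maybe (ι 0ℤ ≡ x)
  is-0 (a + b φ) with 0ℤ ℤ.≟ a | 0ℤ ℤ.≟ b
  ... | yes refl | yes refl = just refl
  ... | _        | _        = nothing

module ℤ[φ] = CommutativeRing ℤφ-commutativeRing

⊝-involutive : ∀ x → ⊝ ⊝ x ≡ x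
⊝-involutive = solve-∀ ℤφ-ring

⊖-identityʳ : ∀ x → x ⊖ ι 0ℤ ≡ x
⊖-identityʳ = solve-∀ ℤφ-ring

⊕-⊖-cancelˡ : ∀ x y → (x ⊕ y) ⊖ x ≡ y
⊕-⊖-cancelˡ = solve-∀ ℤφ-ring

⊕-⊖-cancelʳ : ∀ x y → (x ⊕ y) ⊖ y ≡ x
⊕-⊖-cancelʳ = solve-∀ ℤφ-ring

⊖-⊝ : ∀ x y → x ⊖ ⊝ y ≡ x ⊕ y
⊖-⊝ = solve-∀ ℤφ-ring

⊖-telescope : ∀ z y x → (z ⊖ y) ⊕ (y ⊖ x) ≡ z ⊖ x
⊖-telescope = solve-∀ ℤφ-ring

-- Positivity in ℤ[√5]

_√_<_√_ : ℕ → ℕ → ℕ → ℕ → Set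
x √ k < y √ l = k * (x * x) < l * (y * y)

_√_≤_√_ : ℕ → ℕ → ℕ → ℕ → Set
x √ k ≤ y √ l = k * (x * x) ≤ l * (y * y)

square-reflects-≤ : ∀ {m n} → m * m ≤ n * n → m ≤ n
square-reflects-≤ m²≤n² = ≮⇒≥ λ n<m → <⇒≱ (*-mono-< n<m n<m) m²≤n²

√-cross-≤ : ∀ k l x y x′ y′ → x √ k ≤ y √ l → x′ √ k ≤ y′ √ l →
            k * (x * x′) ≤ l * (y * y′)
√-cross-≤ k l x y x′ y′ h h′ = square-reflects-≤ (begin
  (k * (x * x′)) * (k * (x * x′))     ≡⟨ solve (k ∷ x ∷ x′ ∷ []) ⟩
  (k * (x * x)) * (k * (x′ * x′))     ≤⟨ *-mono-≤ h h′ ⟩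
  (l * (y * y)) * (l * (y′ * y′))     ≡⟨ solve (l ∷ y ∷ y′ ∷ []) ⟩
  (l * (y * y′)) * (l * (y * y′))     ∎)
  where open ≤-Reasoning

√-+-< : ∀ k l x y x′ y′ → x √ k < y √ l → x′ √ k ≤ y′ √ l → (x + x′) √ k < (y + y′) √ l
√-+-< k l x y x′ y′ h h′ = begin-strict
  k * ((x + x′) * (x + x′))                         ≡⟨ solve (k ∷ x ∷ x′ ∷ []) ⟩
  k * (x * x) + 2 * (k * (x * x′)) + k * (x′ * x′)  <⟨ +-mono-<-≤ (+-mono-<-≤ h (*-monoʳ-≤ 2 cross)) h′ ⟩
  l * (y * y) + 2 * (l * (y * y′)) + l * (y′ * y′)  ≡⟨ solve (l ∷ y ∷ y′ ∷ []) ⟩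
  l * ((y + y′) * (y + y′))                         ∎
  where
  open ≤-Reasoning
  cross = √-cross-≤ k l x y x′ y′ (<⇒≤ h) h′

√-mono-≤ : ∀ k {x x′} → x ≤ x′ → k * (x * x) ≤ k * (x′ * x′)
√-mono-≤ k x≤x′ = *-monoʳ-≤ k (*-mono-≤ x≤x′ x≤x′)

data Root5Pos : ℤ → ℤ → Set where
  both-nonneg : ∀ {p q} → 0 < p + q → Root5Pos (+ p) (+ q)
  q-negative  : ∀ {p q} → suc q √ 5 < p √ 1 → Root5Pos (+ p) -[1+ q ]
  p-negative  : ∀ {p q} → suc p √ 1 < q √ 5 → Root5Pos -[1+ p ] (+ q)

toRoot5Pos : ∀ {p q} → PosRoot5 p q → Root5Pos p q
toRoot5Pos {+ p} {+ q} (inj₁ (_ , _ , inj₁ (+<+ 0<p))) = both-nonneg (≤-trans 0<p (m≤m+n p q))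
toRoot5Pos {+ p} {+ q} (inj₁ (_ , _ , inj₂ (+<+ 0<q))) = both-nonneg (≤-trans 0<q (m≤n+m q p))
toRoot5Pos {+ p} { -[1+ q ]} (inj₁ (_ , () , _))
toRoot5Pos { -[1+ p ]} (inj₁ (() , _))
toRoot5Pos {+ zero} (inj₂ (inj₁ (+<+ () , _)))
toRoot5Pos {+ suc p} { -[1+ q ]} (inj₂ (inj₁ (_ , _ , +<+ h))) =
  q-negative (subst (5 * (suc q * suc q) <_) (sym (*-identityˡ (suc p * suc p))) h)
toRoot5Pos {+ suc p} {+ q} (inj₂ (inj₁ (_ , +<+ () , _)))
toRoot5Pos { -[1+ p ]} (inj₂ (inj₁ (() , _)))
toRoot5Pos { -[1+ p ]} {+ zero} (inj₂ (inj₂ (_ , +<+ () , _)))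
toRoot5Pos { -[1+ p ]} {+ suc q} (inj₂ (inj₂ (_ , _ , +<+ h))) =
  p-negative (subst (_< 5 * (suc q * suc q)) (sym (*-identityˡ (suc p * suc p))) h)
toRoot5Pos { -[1+ p ]} { -[1+ q ]} (inj₂ (inj₂ (_ , () , _)))
toRoot5Pos {+ p} (inj₂ (inj₂ (+<+ () , _)))

fromRoot5Pos : ∀ {p q} → Root5Pos p q → PosRoot5 p q
fromRoot5Pos {+ suc p} (both-nonneg _) = inj₁ (+≤+ z≤n , +≤+ z≤n , inj₁ (+<+ (s≤s z≤n)))
fromRoot5Pos {+ zero} {+ suc q} (both-nonneg _) = inj₁ (+≤+ z≤n , +≤+ z≤n , inj₂ (+<+ (s≤s z≤n)))
fromRoot5Pos {+ zero} {+ zero} (both-nonneg ())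
fromRoot5Pos {+ zero} (q-negative ())
fromRoot5Pos {+ suc p} { -[1+ q ]} (q-negative h) =
  inj₂ (inj₁ (+<+ (s≤s z≤n) , -<+ , +<+ (subst (5 * (suc q * suc q) <_) (*-identityˡ (suc p * suc p)) h)))
fromRoot5Pos {q = + zero} (p-negative ())
fromRoot5Pos { -[1+ p ]} {+ suc q} (p-negative h) =
  inj₂ (inj₂ (-<+ , +<+ (s≤s z≤n) , +<+ (subst (_< 5 * (suc q * suc q)) (*-identityˡ (suc p * suc p)) h)))

data ⊖-View (m n : ℕ) : Set where
  ⊖-nonneg : ∀ k → m ≡ n + k → m ℤ.⊖ n ≡ + k → ⊖-View m n
  ⊖-neg : ∀ k → n ≡ m + suc k → m ℤ.⊖ n ≡ -[1+ k ] → ⊖-View m n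

⊖-view : ∀ m n → ⊖-View m n
⊖-view zero    zero    = ⊖-nonneg 0 refl refl
⊖-view (suc m) zero    = ⊖-nonneg (suc m) refl refl
⊖-view zero    (suc n) = ⊖-neg n refl refl
⊖-view (suc m) (suc n) with ⊖-view m n
... | ⊖-nonneg k m≡n+k m⊖n≡k = ⊖-nonneg k (cong suc m≡n+k) (trans (ℤP.[1+m]⊖[1+n]≡m⊖n m n) m⊖n≡k)
... | ⊖-neg k n≡m+k m⊖n≡k = ⊖-neg k (cong suc n≡m+k) (trans (ℤP.[1+m]⊖[1+n]≡m⊖n m n) m⊖n≡k)

√<-positive : ∀ l {x k y} → x √ k < y √ l → 0 < y
√<-positive l {x} {k} {zero} h with () ← subst (k * (x * x) <_) (*-zeroʳ l) h
√<-positive l {y = suc y} h = s≤s z≤n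

nonneg-+-q-negative : ∀ {p q r s} → 0 < p + q → suc s √ 5 < r √ 1 →
                      Root5Pos (+ (p + r)) (q ℤ.⊖ suc s)
nonneg-+-q-negative {p} {q} {r} {s} _ h with ⊖-view q (suc s)
... | ⊖-nonneg k _ q⊖s≡k = subst (Root5Pos _) (sym q⊖s≡k)
  (both-nonneg (≤-trans (√<-positive 1 {suc s} {5} h) (≤-trans (m≤n+m r p) (m≤m+n (p + r) k))))
... | ⊖-neg k s≡q+k q⊖s≡k = subst (Root5Pos _) (sym q⊖s≡k) (q-negative (begin-strict
  5 * (suc k * suc k)     ≤⟨ √-mono-≤ 5 {suc k} {suc s} (subst (suc k ≤_) (sym s≡q+k) (m≤n+m (suc k) q)) ⟩
  5 * (suc s * suc s)     <⟨ h ⟩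
  1 * (r * r)             ≤⟨ √-mono-≤ 1 {r} {p + r} (m≤n+m r p) ⟩
  1 * ((p + r) * (p + r)) ∎))
  where open ≤-Reasoning

nonneg-+-p-negative : ∀ {p q r s} → 0 < p + q → suc r √ 1 < s √ 5 →
                      Root5Pos (p ℤ.⊖ suc r) (+ (q + s))
nonneg-+-p-negative {p} {q} {r} {s} _ h with ⊖-view p (suc r)
... | ⊖-nonneg k _ p⊖r≡k = subst (λ x → Root5Pos x _) (sym p⊖r≡k)
  (both-nonneg (≤-trans (√<-positive 5 {suc r} {1} h) (≤-trans (m≤n+m s q) (m≤n+m (q + s) k))))
... | ⊖-neg k r≡p+k p⊖r≡k = subst (λ x → Root5Pos x _) (sym p⊖r≡k) (p-negative (begin-strict
  1 * (suc k * suc k)     ≤⟨ √-mono-≤ 1 {suc k} {suc r} (subst (suc k ≤_) (sym r≡p+k) (m≤n+m (suc k) p)) ⟩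
  1 * (suc r * suc r)     <⟨ h ⟩
  5 * (s * s)             ≤⟨ √-mono-≤ 5 {s} {q + s} (m≤n+m s q) ⟩
  5 * ((q + s) * (q + s)) ∎))
  where open ≤-Reasoning

q-negative-+ : ∀ {p q r s} → suc q √ 5 < p √ 1 → suc s √ 5 < r √ 1 →
               suc (suc (q + s)) √ 5 < (p + r) √ 1
q-negative-+ {p} {q} {r} {s} h h′ = subst (λ x → x √ 5 < (p + r) √ 1) (cong suc (+-suc q s))
  (√-+-< 5 1 (suc q) p (suc s) r h (<⇒≤ h′))

p-negative-+ : ∀ {p q r s} → suc p √ 1 < q √ 5 → suc r √ 1 < s √ 5 →
               suc (suc (p + r)) √ 1 < (q + s) √ 5
p-negative-+ {p} {q} {r} {s} h h′ = subst (λ x → x √ 1 < (q + s) √ 5) (cong suc (+-suc p r))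
  (√-+-< 1 5 (suc p) q (suc r) s h (<⇒≤ h′))

q-negative-+-p-negative : ∀ {p q r s} → suc q √ 5 < p √ 1 → suc r √ 1 < s √ 5 →
                          Root5Pos (p ℤ.⊖ suc r) (s ℤ.⊖ suc q)
q-negative-+-p-negative {p} {q} {r} {s} h h′ with ⊖-view p (suc r) | ⊖-view s (suc q)
... | ⊖-nonneg zero refl _ | ⊖-nonneg zero refl _ =
  ⊥-elim (<-asym (subst (λ x → suc q √ 5 < x √ 1) (+-identityʳ (suc r)) h)
                 (subst (λ x → suc r √ 1 < x √ 5) (+-identityʳ (suc q)) h′))
... | ⊖-nonneg (suc a) refl e | ⊖-nonneg b refl e′ = subst₂ Root5Pos (sym e) (sym e′) (both-nonneg (s≤s z≤n))
... | ⊖-nonneg zero refl e | ⊖-nonneg (suc b) refl e′ = subst₂ Root5Pos (sym e) (sym e′) (both-nonneg (s≤s z≤n))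
... | ⊖-nonneg a refl e | ⊖-neg b q≡s+b e′ = subst₂ Root5Pos (sym e) (sym e′) (q-negative
  (≰⇒> λ a≤b → <-asym (subst (λ x → x √ 5 < (suc r + a) √ 1) q≡s+b h)
                      (√-+-< 1 5 (suc r) s a (suc b) h′ a≤b)))
... | ⊖-neg a r≡p+a e | ⊖-nonneg b refl e′ = subst₂ Root5Pos (sym e) (sym e′) (p-negative
  (≰⇒> λ b≤a → <-asym (subst (λ x → x √ 1 < (suc q + b) √ 5) r≡p+a h′)
                      (√-+-< 5 1 (suc q) p b (suc a) h b≤a)))
... | ⊖-neg a r≡p+a _ | ⊖-neg b q≡s+b _ = ⊥-elim (<-irrefl refl (begin-strict
  5 * (suc q * suc q) <⟨ h ⟩
  1 * (p * p)         ≤⟨ √-mono-≤ 1 {p} {suc r} (subst (p ≤_) (sym r≡p+a) (m≤m+n p (suc a))) ⟩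
  1 * (suc r * suc r) <⟨ h′ ⟩
  5 * (s * s)         ≤⟨ √-mono-≤ 5 {s} {suc q} (subst (s ≤_) (sym q≡s+b) (m≤m+n s (suc b))) ⟩
  5 * (suc q * suc q) ∎))
  where open ≤-Reasoning

Root5Pos-comm : ∀ p q r s → Root5Pos (r ℤ.+ p) (s ℤ.+ q) → Root5Pos (p ℤ.+ r) (q ℤ.+ s)
Root5Pos-comm p q r s = subst₂ Root5Pos (ℤP.+-comm r p) (ℤP.+-comm s q)

Root5Pos-+ : ∀ {p q r s} → Root5Pos p q → Root5Pos r s → Root5Pos (p ℤ.+ r) (q ℤ.+ s)
Root5Pos-+ (both-nonneg {p} {q} h) (both-nonneg {r} {s} _) =
  both-nonneg (≤-trans h (+-mono-≤ (m≤m+n p r) (m≤m+n q s)))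
Root5Pos-+ (both-nonneg {p} {q} h) (q-negative {r} {s} h′) = nonneg-+-q-negative {p} {q} {r} {s} h h′
Root5Pos-+ (both-nonneg {p} {q} h) (p-negative {r} {s} h′) = nonneg-+-p-negative {p} {q} {r} {s} h h′
Root5Pos-+ (q-negative {p} {q} h) (both-nonneg {r} {s} h′) =
  Root5Pos-comm (+ p) -[1+ q ] (+ r) (+ s) (nonneg-+-q-negative {r} {s} {p} {q} h′ h)
Root5Pos-+ (q-negative {p} {q} h) (q-negative {r} {s} h′) = q-negative (q-negative-+ {p} {q} {r} {s} h h′)
Root5Pos-+ (q-negative {p} {q} h) (p-negative {r} {s} h′) = q-negative-+-p-negative {p} {q} {r} {s} h h′
Root5Pos-+ (p-negative {p} {q} h) (both-nonneg {r} {s} h′) =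
  Root5Pos-comm -[1+ p ] (+ q) (+ r) (+ s) (nonneg-+-p-negative {r} {s} {p} {q} h′ h)
Root5Pos-+ (p-negative {p} {q} h) (q-negative {r} {s} h′) =
  Root5Pos-comm -[1+ p ] (+ q) (+ r) -[1+ s ] (q-negative-+-p-negative {r} {s} {p} {q} h′ h)
Root5Pos-+ (p-negative {p} {q} h) (p-negative {r} {s} h′) = p-negative (p-negative-+ {p} {q} {r} {s} h h′)

Pos-⊕ : ∀ x y → Pos x → Pos y → Pos (x ⊕ y)
Pos-⊕ (a + b φ) (c + d φ) h h′ = subst (λ p → PosRoot5 p (b ℤ.+ d)) (coordinates a b c d)
  (fromRoot5Pos (Root5Pos-+ (toRoot5Pos h) (toRoot5Pos h′)))
  where
  coordinates : ∀ a b c d → (+ 2 ℤ.* a ℤ.+ b) ℤ.+ (+ 2 ℤ.* c ℤ.+ d) ≡ + 2 ℤ.* (a ℤ.+ c) ℤ.+ (b ℤ.+ d)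
  coordinates = ℤ-solve-∀

Pos-ι : ∀ {a} → Pos (ι a) → 0ℤ ℤ.< a
Pos-ι {+ zero} h with both-nonneg () ← toRoot5Pos h
Pos-ι {+ suc n} h = +<+ (s≤s z≤n)
Pos-ι { -[1+ n ]} h with p-negative () ← toRoot5Pos h

PosRoot5-dominant : ∀ {p q} → 0ℤ ℤ.< p → + 5 ℤ.* (q ℤ.* q) ℤ.< p ℤ.* p → PosRoot5 p q
PosRoot5-dominant {q = + n} 0<p _ = inj₁ (ℤP.<⇒≤ 0<p , +≤+ z≤n , inj₁ 0<p)
PosRoot5-dominant {q = -[1+ n ]} 0<p 5q²<p² = inj₂ (inj₁ (0<p , -<+ , 5q²<p²))

PosRoot5-subdominant : ∀ {p q} → 0ℤ ℤ.< q → p ℤ.* p ℤ.< + 5 ℤ.* (q ℤ.* q) → PosRoot5 p q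
PosRoot5-subdominant {p = + n} 0<q _ = inj₁ (+≤+ z≤n , ℤP.<⇒≤ 0<q , inj₂ 0<q)
PosRoot5-subdominant {p = -[1+ n ]} 0<q p²<5q² = inj₂ (inj₂ (-<+ , 0<q , p²<5q²))

norm : ℤφ → ℤ
norm (a + b φ) = a ℤ.* a ℤ.+ a ℤ.* b ℤ.- b ℤ.* b

trace²-norm : ∀ a b → (+ 2 ℤ.* a ℤ.+ b) ℤ.* (+ 2 ℤ.* a ℤ.+ b)
                     ≡ + 5 ℤ.* (b ℤ.* b) ℤ.+ + 4 ℤ.* (a ℤ.* a ℤ.+ a ℤ.* b ℤ.- b ℤ.* b)
trace²-norm = ℤ-solve-∀

Pos-of-norm≡1 : ∀ a b → norm (a + b φ) ≡ 1ℤ → 0ℤ ℤ.< + 2 ℤ.* a ℤ.+ b → Pos (a + b φ)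
Pos-of-norm≡1 a b N≡1 0<p = PosRoot5-dominant 0<p (begin-strict
  + 5 ℤ.* (b ℤ.* b)                          ≡⟨ ℤP.+-identityʳ _ ⟨
  + 5 ℤ.* (b ℤ.* b) ℤ.+ 0ℤ                    <⟨ ℤP.+-monoʳ-< (+ 5 ℤ.* (b ℤ.* b)) (+<+ (s≤s z≤n)) ⟩
  + 5 ℤ.* (b ℤ.* b) ℤ.+ + 4 ℤ.* 1ℤ            ≡⟨ cong (λ N → + 5 ℤ.* (b ℤ.* b) ℤ.+ + 4 ℤ.* N) N≡1 ⟨
  + 5 ℤ.* (b ℤ.* b) ℤ.+ + 4 ℤ.* norm (a + b φ) ≡⟨ trace²-norm a b ⟨
  (+ 2 ℤ.* a ℤ.+ b) ℤ.* (+ 2 ℤ.* a ℤ.+ b)     ∎)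
  where open ℤP.≤-Reasoning

Pos-of-norm≡-1 : ∀ a b → norm (a + b φ) ≡ -1ℤ → 0ℤ ℤ.< b → Pos (a + b φ)
Pos-of-norm≡-1 a b N≡-1 0<b = PosRoot5-subdominant 0<b (begin-strict
  (+ 2 ℤ.* a ℤ.+ b) ℤ.* (+ 2 ℤ.* a ℤ.+ b)     ≡⟨ trace²-norm a b ⟩
  + 5 ℤ.* (b ℤ.* b) ℤ.+ + 4 ℤ.* norm (a + b φ) ≡⟨ cong (λ N → + 5 ℤ.* (b ℤ.* b) ℤ.+ + 4 ℤ.* N) N≡-1 ⟩
  + 5 ℤ.* (b ℤ.* b) ℤ.+ + 4 ℤ.* -1ℤ           <⟨ ℤP.+-monoʳ-< (+ 5 ℤ.* (b ℤ.* b)) -<+ ⟩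
  + 5 ℤ.* (b ℤ.* b) ℤ.+ 0ℤ                    ≡⟨ ℤP.+-identityʳ _ ⟩
  + 5 ℤ.* (b ℤ.* b)                          ∎)
  where open ℤP.≤-Reasoning

Pos⇒0<φ : ∀ x → Pos x → ι 0ℤ <φ x
Pos⇒0<φ x = subst Pos (sym (⊖-identityʳ x))

<φ-trans : ∀ x y z → x <φ y → y <φ z → x <φ z
<φ-trans x y z x<y y<z = subst Pos (⊖-telescope z y x) (Pos-⊕ (z ⊖ y) (y ⊖ x) y<z x<y)

≤φ-<φ-trans : ∀ x y z → x ≤φ y → y <φ z → x <φ z
≤φ-<φ-trans x y z (inj₁ y-x≡0) y<z = subst Pos z-y≡z-x y<z
  where
  z-y≡z-x : z ⊖ y ≡ z ⊖ x
  z-y≡z-x = begin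
    z ⊖ y                ≡⟨ ℤ[φ].+-identityʳ (z ⊖ y) ⟨
    (z ⊖ y) ⊕ ι 0ℤ       ≡⟨ cong ((z ⊖ y) ⊕_) y-x≡0 ⟨
    (z ⊖ y) ⊕ (y ⊖ x)    ≡⟨ ⊖-telescope z y x ⟩
    z ⊖ x                ∎
    where open ≡-Reasoning
≤φ-<φ-trans x y z (inj₂ x<y) y<z = <φ-trans x y z x<y y<z

⊕-monoʳ-<φ : ∀ z x y → x <φ y → z ⊕ x <φ z ⊕ y
⊕-monoʳ-<φ z x y = subst Pos (sym (cancel z x y))
  where
  cancel : ∀ z x y → (z ⊕ y) ⊖ (z ⊕ x) ≡ y ⊖ x
  cancel = solve-∀ ℤφ-ring

⊝-<φ : ∀ x y → x <φ y → ⊝ y <φ ⊝ x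
⊝-<φ x y = subst Pos (sym (flip x y))
  where
  flip : ∀ x y → ⊝ x ⊖ ⊝ y ≡ y ⊖ x
  flip = solve-∀ ℤφ-ring

ιℕ-<φ-reflect : ∀ {m n} → ιℕ m <φ ιℕ n → m < n
ιℕ-<φ-reflect {m} {n} ιm<ιn with ⊖-view n m | subst (0ℤ ℤ.<_) (ℤP.m-n≡m⊖n n m) (Pos-ι ιm<ιn)
... | ⊖-nonneg k n≡m+k n⊖m≡k | 0<n⊖m =
  subst (m <_) (sym n≡m+k) (m<m+n m (ℤP.drop‿+<+ (subst (0ℤ ℤ.<_) n⊖m≡k 0<n⊖m)))
... | ⊖-neg k _ n⊖m≡k | 0<n⊖m with () ← subst (0ℤ ℤ.<_) n⊖m≡k 0<n⊖m

-- Powers of φ⁻¹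

alt : ℕ → ℤφ → ℤφ
alt zero    x = x
alt (suc n) x = ⊝ alt n x

alt-⊝ : ∀ n x → alt n (⊝ x) ≡ ⊝ alt n x
alt-⊝ zero    x = refl
alt-⊝ (suc n) x = cong ⊝_ (alt-⊝ n x)

alt-0 : ∀ n → alt n (ι 0ℤ) ≡ ι 0ℤ
alt-0 zero    = refl
alt-0 (suc n) = cong ⊝_ (alt-0 n)

alt-⊕ : ∀ n x y → alt n (x ⊕ y) ≡ alt n x ⊕ alt n y
alt-⊕ zero    x y = refl
alt-⊕ (suc n) x y = trans (cong ⊝_ (alt-⊕ n x y)) (⊝-distrib-⊕ (alt n x) (alt n y))
  where
  ⊝-distrib-⊕ : ∀ x y → ⊝ (x ⊕ y) ≡ ⊝ x ⊕ ⊝ y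
  ⊝-distrib-⊕ = solve-∀ ℤφ-ring

alt-⊗ : ∀ n y x → alt n (y ⊗ x) ≡ y ⊗ alt n x
alt-⊗ zero    y x = refl
alt-⊗ (suc n) y x = trans (cong ⊝_ (alt-⊗ n y x)) (⊝-⊗ y (alt n x))
  where
  ⊝-⊗ : ∀ y x → ⊝ (y ⊗ x) ≡ y ⊗ ⊝ x
  ⊝-⊗ = solve-∀ ℤφ-ring

alt-involutive : ∀ n x → alt n (alt n x) ≡ x
alt-involutive zero    x = refl
alt-involutive (suc n) x = begin
  ⊝ alt n (⊝ alt n x)  ≡⟨ cong ⊝_ (alt-⊝ n (alt n x)) ⟩
  ⊝ ⊝ alt n (alt n x)  ≡⟨ ⊝-involutive _ ⟩
  alt n (alt n x)      ≡⟨ alt-involutive n x ⟩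
  x                    ∎
  where open ≡-Reasoning

parity : ∀ n → n % 2 ≡ 0 ⊎ n % 2 ≡ 1
parity zero          = inj₁ refl
parity (suc zero)    = inj₂ refl
parity (suc (suc n)) = parity n

alt-even : ∀ n x → n % 2 ≡ 0 → alt n x ≡ x
alt-even zero          x _    = refl
alt-even (suc (suc n)) x even = trans (⊝-involutive (alt n x)) (alt-even n x even)

alt-odd : ∀ n x → n % 2 ≡ 1 → alt n x ≡ ⊝ x
alt-odd (suc zero)    x _   = refl
alt-odd (suc (suc n)) x odd = trans (⊝-involutive (alt n x)) (alt-odd n x odd)

-- ψⁿ for the conjugate ψ = 1 − φ = −φ⁻¹, in Binet's form F_{n+1} − F_n φ
ψ^ : ℕ → ℤφ
ψ^ n = (+ fib (suc n)) + (ℤ.- (+ fib n)) φ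

φ⁻¹⊗ψ^ : ∀ n → φ⁻¹ ⊗ ψ^ n ≡ ⊝ ψ^ (suc n)
φ⁻¹⊗ψ^ n = ℤφ-ext (re-law (+ fib (suc n)) (+ fib n)) (im-law (+ fib (suc n)) (+ fib n))
  where
  re-law : ∀ a b → -1ℤ ℤ.* a ℤ.+ 1ℤ ℤ.* (ℤ.- b) ≡ ℤ.- (a ℤ.+ b)
  re-law = ℤ-solve-∀
  im-law : ∀ a b → -1ℤ ℤ.* (ℤ.- b) ℤ.+ 1ℤ ℤ.* a ℤ.+ 1ℤ ℤ.* (ℤ.- b) ≡ ℤ.- (ℤ.- a)
  im-law = ℤ-solve-∀

φ⁻^≡alt-ψ^ : ∀ n → φ⁻^ n ≡ alt n (ψ^ n)
φ⁻^≡alt-ψ^ zero    = refl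
φ⁻^≡alt-ψ^ (suc n) = begin
  φ⁻¹ ⊗ φ⁻^ n              ≡⟨ cong (φ⁻¹ ⊗_) (φ⁻^≡alt-ψ^ n) ⟩
  φ⁻¹ ⊗ alt n (ψ^ n)       ≡⟨ alt-⊗ n φ⁻¹ (ψ^ n) ⟨
  alt n (φ⁻¹ ⊗ ψ^ n)       ≡⟨ cong (alt n) (φ⁻¹⊗ψ^ n) ⟩
  alt n (⊝ ψ^ (suc n))     ≡⟨ alt-⊝ n (ψ^ (suc n)) ⟩
  alt (suc n) (ψ^ (suc n)) ∎
  where open ≡-Reasoning

norm-⊝ : ∀ x → norm (⊝ x) ≡ norm x
norm-⊝ x = identity (re x) (im x)
  where
  identity : ∀ a b → ℤ.- a ℤ.* ℤ.- a ℤ.+ ℤ.- a ℤ.* ℤ.- b ℤ.- ℤ.- b ℤ.* ℤ.- b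
                   ≡ a ℤ.* a ℤ.+ a ℤ.* b ℤ.- b ℤ.* b
  identity = ℤ-solve-∀

cassini : ∀ n → norm (ψ^ (suc n)) ≡ ℤ.- norm (ψ^ n)
cassini n = identity (+ fib (suc n)) (+ fib n)
  where
  identity : ∀ a b → (a ℤ.+ b) ℤ.* (a ℤ.+ b) ℤ.+ (a ℤ.+ b) ℤ.* ℤ.- a ℤ.- ℤ.- a ℤ.* ℤ.- a
                   ≡ ℤ.- (a ℤ.* a ℤ.+ a ℤ.* ℤ.- b ℤ.- ℤ.- b ℤ.* ℤ.- b)
  identity = ℤ-solve-∀

norm-ψ^-suc-suc : ∀ n → norm (ψ^ (suc (suc n))) ≡ norm (ψ^ n)
norm-ψ^-suc-suc n = begin
  norm (ψ^ (suc (suc n)))   ≡⟨ cassini (suc n) ⟩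
  ℤ.- norm (ψ^ (suc n))     ≡⟨ cong ℤ.-_ (cassini n) ⟩
  ℤ.- ℤ.- norm (ψ^ n)       ≡⟨ ℤP.neg-involutive _ ⟩
  norm (ψ^ n)               ∎
  where open ≡-Reasoning

norm-ψ^-even : ∀ n → n % 2 ≡ 0 → norm (ψ^ n) ≡ 1ℤ
norm-ψ^-even zero          _    = refl
norm-ψ^-even (suc (suc n)) even = trans (norm-ψ^-suc-suc n) (norm-ψ^-even n even)

norm-ψ^-odd : ∀ n → n % 2 ≡ 1 → norm (ψ^ n) ≡ -1ℤ
norm-ψ^-odd (suc zero)    _   = refl
norm-ψ^-odd (suc (suc n)) odd = trans (norm-ψ^-suc-suc n) (norm-ψ^-odd n odd)

fib-positive : ∀ n → 0 < fib (suc n)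
fib-positive zero    = s≤s z≤n
fib-positive (suc n) = ≤-trans (fib-positive n) (m≤m+n _ _)

trace-ψ^-positive : ∀ n → 0ℤ ℤ.< + 2 ℤ.* re (ψ^ n) ℤ.+ im (ψ^ n)
trace-ψ^-positive zero    = +<+ (s≤s z≤n)
trace-ψ^-positive (suc n) = subst (0ℤ ℤ.<_) (sym (identity (+ fib (suc n)) (+ fib n)))
  (+<+ (≤-trans (fib-positive n) (m≤m+n _ _)))
  where
  identity : ∀ a b → + 2 ℤ.* (a ℤ.+ b) ℤ.+ ℤ.- a ≡ a ℤ.+ (b ℤ.+ b)
  identity = ℤ-solve-∀

φ⁻^-positive : ∀ n → Pos (φ⁻^ n)
φ⁻^-positive n with parity n
... | inj₁ even = subst Pos (sym (trans (φ⁻^≡alt-ψ^ n) (alt-even n (ψ^ n) even)))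
  (Pos-of-norm≡1 (re (ψ^ n)) (im (ψ^ n)) (norm-ψ^-even n even) (trace-ψ^-positive n))
... | inj₂ odd = subst Pos (sym (trans (φ⁻^≡alt-ψ^ n) (alt-odd n (ψ^ n) odd)))
  (Pos-of-norm≡-1 (re (⊝ ψ^ n)) (im (⊝ ψ^ n))
    (trans (norm-⊝ (ψ^ n)) (norm-ψ^-odd n odd)) (im-positive n odd))
  where
  im-positive : ∀ n → n % 2 ≡ 1 → 0ℤ ℤ.< im (⊝ ψ^ n)
  im-positive (suc n) _ = subst (0ℤ ℤ.<_) (sym (ℤP.neg-involutive _)) (+<+ (fib-positive n))

φ⁻^-split : ∀ n → φ⁻^ n ≡ φ⁻^ (suc n) ⊕ φ⁻^ (suc (suc n))
φ⁻^-split n = identity (φ⁻^ n)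
  where
  identity : ∀ x → x ≡ φ⁻¹ ⊗ x ⊕ φ⁻¹ ⊗ (φ⁻¹ ⊗ x)
  identity = solve-∀ ℤφ-ring

φ⁻^-decreasing : ∀ n → φ⁻^ (suc n) <φ φ⁻^ n
φ⁻^-decreasing n = subst Pos (sym (begin
  φ⁻^ n ⊖ φ⁻^ (suc n)                               ≡⟨ cong (_⊖ φ⁻^ (suc n)) (φ⁻^-split n) ⟩
  (φ⁻^ (suc n) ⊕ φ⁻^ (suc (suc n))) ⊖ φ⁻^ (suc n)   ≡⟨ ⊕-⊖-cancelˡ (φ⁻^ (suc n)) (φ⁻^ (suc (suc n))) ⟩
  φ⁻^ (suc (suc n))                                 ∎)) (φ⁻^-positive (suc (suc n)))
  where open ≡-Reasoning

φ⁻^-gap : ∀ n → φ⁻^ n ⊖ φ⁻^ (suc (suc n)) ≡ φ⁻^ (suc n)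
φ⁻^-gap n = trans (cong (_⊖ φ⁻^ (suc (suc n))) (φ⁻^-split n)) (⊕-⊖-cancelʳ (φ⁻^ (suc n)) (φ⁻^ (suc (suc n))))

⊝φ⁻^<φ0 : ∀ n → ⊝ φ⁻^ n <φ ι 0ℤ
⊝φ⁻^<φ0 n = ⊝-<φ (ι 0ℤ) (φ⁻^ n) (Pos⇒0<φ (φ⁻^ n) (φ⁻^-positive n))

-- Zeckendorf sums

-- altSum m β = Σₖ βₖ (−1)ᵏ φ^{−(m+1+k)}  (k counted from 0)
altSum : ℕ → List Bool → ℤφ
altSum m []           = ι 0ℤ
altSum m (false ∷ bs) = ⊝ altSum (suc m) bs
altSum m (true ∷ bs)  = φ⁻^ (suc m) ⊖ altSum (suc m) bs

alt-φ⁻^-suc : ∀ n → alt n (φ⁻^ (suc n)) ≡ ⊝ ψ^ (suc n)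
alt-φ⁻^-suc n = begin
  alt n (φ⁻^ (suc n))              ≡⟨ cong (alt n) (φ⁻^≡alt-ψ^ (suc n)) ⟩
  alt n (⊝ alt n (ψ^ (suc n)))     ≡⟨ alt-⊝ n (alt n (ψ^ (suc n))) ⟩
  ⊝ alt n (alt n (ψ^ (suc n)))     ≡⟨ cong ⊝_ (alt-involutive n (ψ^ (suc n))) ⟩
  ⊝ ψ^ (suc n)                     ∎
  where open ≡-Reasoning

φ⁻¹⊗fib : ∀ n → φ⁻¹ ⊗ ιℕ (fib (suc n)) ≡ ιℕ (fib n) ⊕ alt n (φ⁻^ (suc n))
φ⁻¹⊗fib n = begin
  φ⁻¹ ⊗ ιℕ (fib (suc n))            ≡⟨ ℤφ-ext (re-law F₁ F₀) (im-law F₁ F₀) ⟩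
  ιℕ (fib n) ⊕ φ⁻¹ ⊗ ψ^ n           ≡⟨ cong (ιℕ (fib n) ⊕_) (trans (φ⁻¹⊗ψ^ n) (sym (alt-φ⁻^-suc n))) ⟩
  ιℕ (fib n) ⊕ alt n (φ⁻^ (suc n))  ∎
  where
  open ≡-Reasoning
  F₁ F₀ : ℤ
  F₁ = + fib (suc n)
  F₀ = + fib n
  re-law : ∀ a b → -1ℤ ℤ.* a ℤ.+ 1ℤ ℤ.* 0ℤ ≡ b ℤ.+ (-1ℤ ℤ.* a ℤ.+ 1ℤ ℤ.* ℤ.- b)
  re-law = ℤ-solve-∀
  im-law : ∀ a b → -1ℤ ℤ.* 0ℤ ℤ.+ 1ℤ ℤ.* a ℤ.+ 1ℤ ℤ.* 0ℤ ≡ 0ℤ ℤ.+ (-1ℤ ℤ.* ℤ.- b ℤ.+ 1ℤ ℤ.* a ℤ.+ 1ℤ ℤ.* ℤ.- b)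
  im-law = ℤ-solve-∀

φ⁻¹⊗fibSumFrom : ∀ i bs →
  φ⁻¹ ⊗ ιℕ (fibSumFrom (suc i) bs) ≡ ιℕ (fibSumFrom i bs) ⊕ alt (suc i) (altSum (suc i) bs)
φ⁻¹⊗fibSumFrom i [] = cong (ι 0ℤ ⊕_) (sym (alt-0 (suc i)))
φ⁻¹⊗fibSumFrom i (false ∷ bs) =
  trans (φ⁻¹⊗fibSumFrom (suc i) bs) (cong (ιℕ (fibSumFrom (suc i) bs) ⊕_) (sym (alt-⊝ (suc i) _)))
φ⁻¹⊗fibSumFrom i (true ∷ bs) = begin
  φ⁻¹ ⊗ (ιℕ F ⊕ ιℕ S)                  ≡⟨ ℤ[φ].distribˡ φ⁻¹ (ιℕ F) (ιℕ S) ⟩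
  φ⁻¹ ⊗ ιℕ F ⊕ φ⁻¹ ⊗ ιℕ S              ≡⟨ cong₂ _⊕_ (φ⁻¹⊗fib (suc i)) (φ⁻¹⊗fibSumFrom (suc i) bs) ⟩
  (ιℕ F′ ⊕ alt (suc i) P) ⊕ (ιℕ S′ ⊕ alt (suc (suc i)) A)
                                       ≡⟨ interchange (ιℕ F′) (alt (suc i) P) (ιℕ S′) _ ⟩
  (ιℕ F′ ⊕ ιℕ S′) ⊕ (alt (suc i) P ⊕ alt (suc (suc i)) A)
                                       ≡⟨ cong (λ x → (ιℕ F′ ⊕ ιℕ S′) ⊕ (alt (suc i) P ⊕ x)) (alt-⊝ (suc i) A) ⟨
  (ιℕ F′ ⊕ ιℕ S′) ⊕ (alt (suc i) P ⊕ alt (suc i) (⊝ A))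
                                       ≡⟨ cong ((ιℕ F′ ⊕ ιℕ S′) ⊕_) (alt-⊕ (suc i) P (⊝ A)) ⟨
  ιℕ (F′ + S′) ⊕ alt (suc i) (P ⊖ A)   ∎
  where
  open ≡-Reasoning
  F S F′ S′ : ℕ
  F = fib (suc (suc i))
  S = fibSumFrom (suc (suc i)) bs
  F′ = fib (suc i)
  S′ = fibSumFrom (suc i) bs
  P A : ℤφ
  P = φ⁻^ (suc (suc i))
  A = altSum (suc (suc i)) bs
  interchange : ∀ a b c d → (a ⊕ b) ⊕ (c ⊕ d) ≡ (a ⊕ c) ⊕ (b ⊕ d)
  interchange = solve-∀ ℤφ-ring

mutual
  altSum-bounds : ∀ m bs → NoConsecutiveOnes bs →
                  (⊝ φ⁻^ (suc m) <φ altSum m bs) × (altSum m bs <φ φ⁻^ m)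
  altSum-bounds m [] _ = ⊝φ⁻^<φ0 (suc m) , Pos⇒0<φ (φ⁻^ m) (φ⁻^-positive m)
  altSum-bounds m (false ∷ bs) nco with altSum-bounds (suc m) bs nco
  ... | lo , hi = ⊝-<φ A (φ⁻^ (suc m)) hi ,
                  <φ-trans (⊝ A) (φ⁻^ (suc (suc m))) (φ⁻^ m)
                    (subst (⊝ A <φ_) (⊝-involutive (φ⁻^ (suc (suc m)))) (⊝-<φ (⊝ φ⁻^ (suc (suc m))) A lo))
                    (<φ-trans (φ⁻^ (suc (suc m))) (φ⁻^ (suc m)) (φ⁻^ m)
                      (φ⁻^-decreasing (suc m)) (φ⁻^-decreasing m))
    where
    A : ℤφ
    A = altSum (suc m) bs
  altSum-bounds m (true ∷ bs) nco with altSum-bounds-leading m bs nco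
  ... | lo , hi = <φ-trans (⊝ φ⁻^ (suc m)) (φ⁻^ (suc (suc m))) (altSum m (true ∷ bs))
                    (<φ-trans (⊝ φ⁻^ (suc m)) (ι 0ℤ) (φ⁻^ (suc (suc m)))
                      (⊝φ⁻^<φ0 (suc m)) (Pos⇒0<φ (φ⁻^ (suc (suc m))) (φ⁻^-positive (suc (suc m)))))
                    lo ,
                  hi

  altSum-bounds-leading : ∀ m bs → NoConsecutiveOnes (true ∷ bs) →
    (φ⁻^ (suc (suc m)) <φ altSum m (true ∷ bs)) × (altSum m (true ∷ bs) <φ φ⁻^ m)
  altSum-bounds-leading m [] _ =
    subst (φ⁻^ (suc (suc m)) <φ_) (sym (⊖-identityʳ (φ⁻^ (suc m)))) (φ⁻^-decreasing (suc m)) ,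
    subst (_<φ φ⁻^ m) (sym (⊖-identityʳ (φ⁻^ (suc m)))) (φ⁻^-decreasing m)
  altSum-bounds-leading m (false ∷ bs) nco with altSum-bounds (suc (suc m)) bs nco
  ... | lo , hi =
    subst₂ _<φ_ (φ⁻^-gap (suc m)) (sym (⊖-⊝ (φ⁻^ (suc m)) A))
      (⊕-monoʳ-<φ (φ⁻^ (suc m)) (⊝ φ⁻^ (suc (suc (suc m)))) A lo) ,
    subst₂ _<φ_ (sym (⊖-⊝ (φ⁻^ (suc m)) A)) (sym (φ⁻^-split m))
      (⊕-monoʳ-<φ (φ⁻^ (suc m)) A (φ⁻^ (suc (suc m))) hi)
    where
    A : ℤφ
    A = altSum (suc (suc m)) bs
  altSum-bounds-leading m (true ∷ bs) ()

altSum-leading-zeros : ∀ d m β → NoConsecutiveOnes β →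
  (∀ i → 1 ≤ i → i < suc d → bit β i ≡ false) → bit β (suc d) ≡ true →
  ∃[ bs ] NoConsecutiveOnes (true ∷ bs) × altSum m β ≡ alt d (altSum (m + d) (true ∷ bs))
altSum-leading-zeros zero m (true ∷ bs) nco _ _ = bs , nco , cong (λ k → altSum k (true ∷ bs)) (sym (+-identityʳ m))
altSum-leading-zeros (suc d) m (true ∷ β) _ zeros _ with () ← zeros 1 (s≤s z≤n) (s≤s (s≤s z≤n))
altSum-leading-zeros (suc d) m (false ∷ β) nco zeros one
  with altSum-leading-zeros d (suc m) β nco (λ { (suc i) _ i<d → zeros (suc (suc i)) (s≤s z≤n) (s≤s i<d) }) one
... | bs , nco′ , eq = bs , nco′ ,
  trans (cong ⊝_ eq) (cong (λ k → alt (suc d) (altSum k (true ∷ bs))) (sym (+-suc m d)))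

IsFloor-unique : ∀ {u w r} → IsFloor u r → IsFloor w r → u ≡ w
IsFloor-unique {u} {w} {r} (u≤r , r<u+1) (w≤r , r<w+1) = ≤-antisym
  (≤-pred (ιℕ-<φ-reflect (≤φ-<φ-trans (ιℕ u) r (ιℕ (suc w)) u≤r r<w+1)))
  (≤-pred (ιℕ-<φ-reflect (≤φ-<φ-trans (ιℕ w) r (ιℕ (suc u)) w≤r r<u+1)))

IsFloor-+-fraction : ∀ w t → ι 0ℤ <φ t → t <φ ι 1ℤ → IsFloor w (ιℕ w ⊕ t)
IsFloor-+-fraction w t 0<t t<1 =
  inj₂ (subst (_<φ ιℕ w ⊕ t) (ℤ[φ].+-identityʳ (ιℕ w)) (⊕-monoʳ-<φ (ιℕ w) (ι 0ℤ) t 0<t)) ,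
  subst (ιℕ w ⊕ t <φ_) (ℤ[φ].+-comm (ιℕ w) (ι 1ℤ)) (⊕-monoʳ-<φ (ιℕ w) t (ι 1ℤ) t<1)

-- Hofstadter G pairs

φ⁻¹⊗Zeckendorf : ∀ {v β} → IsZeckendorf v β →
                 φ⁻¹ ⊗ ιℕ v ≡ ιℕ (fibSumFrom 0 β) ⊖ altSum 1 β
φ⁻¹⊗Zeckendorf {β = β} (FibSum≡v , _) =
  subst (λ n → φ⁻¹ ⊗ ιℕ n ≡ ιℕ (fibSumFrom 0 β) ⊖ altSum 1 β) FibSum≡v (φ⁻¹⊗fibSumFrom 0 β)

G-Zeckendorf : ∀ {u v β} → HofstadterGPair u v → IsZeckendorf v β → u ≡ fibSumFrom 0 β
G-Zeckendorf {u} {v} {β} (_ , _ , u-floor) zeck@(_ , _ , nco) =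
  IsFloor-unique {r = φ⁻¹ ⊗ ιℕ (suc v)} u-floor (subst (IsFloor w) (sym r≡w+t) (IsFloor-+-fraction w t 0<t t<1))
  where
  w : ℕ
  w = fibSumFrom 0 β
  E t : ℤφ
  E = altSum 1 β
  t = φ⁻¹ ⊖ E
  r≡w+t : φ⁻¹ ⊗ ιℕ (suc v) ≡ ιℕ w ⊕ t
  r≡w+t = begin
    φ⁻¹ ⊗ (ι 1ℤ ⊕ ιℕ v)          ≡⟨ ℤ[φ].distribˡ φ⁻¹ (ι 1ℤ) (ιℕ v) ⟩
    φ⁻¹ ⊗ ι 1ℤ ⊕ φ⁻¹ ⊗ ιℕ v      ≡⟨ cong (φ⁻¹ ⊗ ι 1ℤ ⊕_) (φ⁻¹⊗Zeckendorf zeck) ⟩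
    φ⁻¹ ⊗ ι 1ℤ ⊕ (ιℕ w ⊖ E)      ≡⟨ rearrange (ιℕ w) E ⟩
    ιℕ w ⊕ (φ⁻¹ ⊖ E)             ∎
    where
    open ≡-Reasoning
    rearrange : ∀ w e → φ⁻¹ ⊗ ι 1ℤ ⊕ (w ⊖ e) ≡ w ⊕ (φ⁻¹ ⊖ e)
    rearrange = solve-∀ ℤφ-ring
  E-bounds : (⊝ φ⁻^ 2 <φ E) × (E <φ φ⁻^ 1)
  E-bounds = altSum-bounds 1 β nco
  0<t : ι 0ℤ <φ t
  0<t = Pos⇒0<φ t (proj₂ E-bounds)
  t<1 : t <φ ι 1ℤ
  t<1 = subst (t <φ_) (sym (φ⁻^-split 0)) (⊕-monoʳ-<φ φ⁻¹ (⊝ E) (φ⁻^ 2)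
          (subst (⊝ E <φ_) (⊝-involutive (φ⁻^ 2)) (⊝-<φ (⊝ φ⁻^ 2) E (proj₁ E-bounds))))

δ-Zeckendorf : ∀ {u v β} → HofstadterGPair u v → IsZeckendorf v β → δ u v ≡ ⊝ altSum 1 β
δ-Zeckendorf {u} {v} {β} G zeck = begin
  ⊝ ιℕ u ⊕ φ⁻¹ ⊗ ιℕ v                       ≡⟨ cong₂ (λ n x → ⊝ ιℕ n ⊕ x) (G-Zeckendorf G zeck) (φ⁻¹⊗Zeckendorf zeck) ⟩
  ⊝ ιℕ w ⊕ (ιℕ w ⊖ altSum 1 β)              ≡⟨ cancel (ιℕ w) (altSum 1 β) ⟩
  ⊝ altSum 1 β                              ∎
  where
  open ≡-Reasoning
  w : ℕ
  w = fibSumFrom 0 β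
  cancel : ∀ w e → ⊝ w ⊕ (w ⊖ e) ≡ ⊝ e
  cancel = solve-∀ ℤφ-ring

lemma9 : (j u v : ℕ) → 1 ≤ j → HofstadterGPair u v →
         (β : List Bool) → IsZeckendorf v β →
         (∀ i → 1 ≤ i → i < j → bit β i ≡ false) → bit β j ≡ true →
         (j % 2 ≡ 1 → (⊝ φ⁻^ j <φ δ u v) × (δ u v <φ ⊝ φ⁻^ (j + 2)))
         × (j % 2 ≡ 0 → (φ⁻^ (j + 2) <φ δ u v) × (δ u v <φ φ⁻^ j))
lemma9 zero _ _ () _ _ _ _ _
lemma9 (suc d) u v _ G β zeck@(_ , _ , nco) zeros one
  with altSum-leading-zeros d 1 β nco zeros one
... | bs , nco′ , E≡alt-X = odd , even
  where
  j : ℕ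
  j = suc d
  X : ℤφ
  X = altSum j (true ∷ bs)
  δ≡alt-X : δ u v ≡ alt j X
  δ≡alt-X = trans (δ-Zeckendorf G zeck) (cong ⊝_ E≡alt-X)
  X-bounds : (φ⁻^ (suc (suc j)) <φ X) × (X <φ φ⁻^ j)
  X-bounds = altSum-bounds-leading j bs nco′
  odd : j % 2 ≡ 1 → (⊝ φ⁻^ j <φ δ u v) × (δ u v <φ ⊝ φ⁻^ (j + 2))
  odd j-odd = subst₂ (λ x k → (⊝ φ⁻^ j <φ x) × (x <φ ⊝ φ⁻^ k))
    (sym (trans δ≡alt-X (alt-odd j X j-odd))) (+-comm 2 j)
    (⊝-<φ X (φ⁻^ j) (proj₂ X-bounds) , ⊝-<φ (φ⁻^ (suc (suc j))) X (proj₁ X-bounds))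
  even : j % 2 ≡ 0 → (φ⁻^ (j + 2) <φ δ u v) × (δ u v <φ φ⁻^ j)
  even j-even = subst₂ (λ x k → (φ⁻^ k <φ x) × (x <φ φ⁻^ j))
    (sym (trans δ≡alt-X (alt-even j X j-even))) (+-comm 2 j) X-bounds
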